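{- Let $T$ be a (left or right) concatenation tree and $\alpha_1,\dots,\alpha_t$ its node labels in RCL order, indices modulo $t$, with $c_i$ the change index of $\alpha_i$. Fix $j$. If $\alpha_j$ is not an ancestor of $\alpha_{j-1}$, and $\alpha_{j-1}$ has period $p<n$ with acceptable range $\{kp+1,\dots,kp+p\}$, then $c_j>kp$.
   Context: Strings of length $n$ over a finite ordered alphabet. The period of $\alpha$ is $|\beta|$ for the shortest $\beta$ with $\alpha=\beta^q$. A PCR-based cycle-joining tree $\mathcal{T}$ is a rooted tree whose nodes are distinct rotation classes of strings, each named by its lexicographically least rotation (necklace), where the edge from node $u$ to child $v$ is labeled by a conjugate pair $(\mathtt{x}\beta,\mathtt{y}\beta)$ ($\mathtt{x}\neq\mathtt{y}$ symbols, $|\beta|=n-1$) with $\mathtt{x}\beta$ a rotation in $u$ and $\mathtt{y}\beta$ a rotation in $v$; it satisfies the Chain Property if no node has two children with edge labels sharing the same $\beta$. A concatenation tree $\mathrm{concat}(\mathcal{T},c,\ell)$, for such $\mathcal{T}$ with the Chain Property, $c\in\{1,\dots,n\}$, $\ell\in\{\mathit{left},\mathit{right}\}$, has the same nodes and parent relation, each node carrying a label (a rotation in its class) and a change index: the root has label its necklace and change index $c$; if a node has label $\alpha$, change index $c'$ and period $p$, with $jp<c'\le jp+p$, its acceptable range is $\{jp+1,\dots,jp+p\}$; a child joined by $(\mathtt{x}\beta,\mathtt{y}\beta)$ gets label $\beta_1\mathtt{y}\beta_2$ and change index $|\beta_1|+1$, where $\alpha=\beta_1\mathtt{x}\beta_2$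 is the unique factorization with $\beta_2\beta_1=\beta$ and $|\beta_1|+1$ in the acceptable range. Children with change index $<c'$ are left-children, $>c'$ right-children, and $=c'$ left-children if $\ell=\mathit{left}$, right-children if $\ell=\mathit{right}$; each type ordered by increasing change index. RCL order: recursively, the right-children subtrees first to last, then the node, then the left-children subtrees first to last. -}

module Defs where

open import Data.Nat using (ℕ; zero; suc; _+_; _*_; _≤_; _<_; _<ᵇ_; _≡ᵇ_)
open import Data.Nat.DivMod using (_mod_)
open import Data.Fin as Fin using (Fin; toℕ)
open import Data.Vec using (Vec; []; _∷_; lookup; tabulate; toList)
open import Data.List as List using (List; []; _∷_; _++_; length; replicate; concat; map)
open import Data.List.Relation.Unary.All using (All)
open import Data.List.Relation.Unary.AllPairs using (AllPairs)
open import Data.List.Relation.Binary.Pointwise using (Pointwise)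
open import Data.Bool using (Bool; true; false; _∨_; _∧_; if_then_else_)
open import Data.Product using (Σ; ∃; ∃₂; _×_; _,_; proj₁; proj₂)
open import Data.Sum using (_⊎_)
open import Data.Unit using (⊤)
open import Relation.Binary.PropositionalEquality using (_≡_; _≢_)
open import Relation.Nullary using (¬_)

Str : ℕ → ℕ → Set
Str k n = Vec (Fin k) n

rot : ∀ {k m} → ℕ → Str k (suc m) → Str k (suc m)
rot {m = m} r α = tabulate (λ j → lookup α ((toℕ j + r) mod (suc m)))

IsRotation : ∀ {k m} → Str k (suc m) → Str k (suc m) → Set
IsRotation a b = ∃ λ r → b ≡ rot r a

_≤lex_ : ∀ {k n} → Str k n → Str k n → Set
[] ≤lex [] = ⊤
(a ∷ as) ≤lex (b ∷ bs) = (a Fin.< b) ⊎ (a ≡ b × as ≤lex bs)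

IsNecklace : ∀ {k m} → Str k (suc m) → Set
IsNecklace α = ∀ r → α ≤lex rot r α

IsPower : ∀ {k n} → ℕ → Str k n → Set
IsPower {k} p α = ∃₂ λ (q : ℕ) (β : List (Fin k)) → length β ≡ p × toList α ≡ concat (replicate q β)

Period : ∀ {k n} → Str k n → ℕ → Set
Period α p = IsPower p α × (∀ p' → IsPower p' α → p ≤ p')

-- conjugate pair label (xβ, yβ), |β| = n - 1 = m
record Edge (k m : ℕ) : Set where
  constructor edge
  field
    x : Fin k
    y : Fin k
    β : Vec (Fin k) m
open Edge public

-- PCR-based cycle-joining tree: each node is named by a string (its necklace),
-- children listed with the conjugate pair labelling the edge.
data PTree (k m : ℕ) : Set where
  node : Str k (suc m) → List (Edge k m × PTree k m) → PTree k m

rootStr : ∀ {k m} → PTree k m → Str k (suc m)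
rootStr (node s _) = s

mutual
  nodes : ∀ {k m} → PTree k m → List (Str k (suc m))
  nodes (node s ch) = s ∷ nodesCh ch

  nodesCh : ∀ {k m} → List (Edge k m × PTree k m) → List (Str k (suc m))
  nodesCh [] = []
  nodesCh ((_ , t) ∷ ts) = nodes t ++ nodesCh ts

data ValidPCR {k m : ℕ} : PTree k m → Set where
  valid : ∀ {s ch} → IsNecklace s →
          All (λ et → (x (proj₁ et) ≢ y (proj₁ et))
                    × IsRotation s (x (proj₁ et) ∷ β (proj₁ et))
                    × IsRotation (rootStr (proj₂ et)) (y (proj₁ et) ∷ β (proj₁ et))
                    × ValidPCR (proj₂ et)) ch →
          ValidPCR (node s ch)

DistinctClasses : ∀ {k m} → PTree k m → Set
DistinctClasses T = AllPairs (λ a b → ¬ IsRotation a b) (nodes T)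

data ChainProperty {k m : ℕ} : PTree k m → Set where
  chain : ∀ {s ch} → AllPairs (λ e f → β (proj₁ e) ≢ β (proj₁ f)) ch →
          All (λ et → ChainProperty (proj₂ et)) ch →
          ChainProperty (node s ch)

-- labelled tree: label, change index, children
data LTree (k m : ℕ) : Set where
  lnode : Str k (suc m) → ℕ → List (LTree k m) → LTree k m

-- A node with label α and change index c' has child (joined by e) with label lab
-- and change index ci: α = β₁ x β₂ with β₂β₁ = β, |β₁|+1 in the acceptable range
-- {qp+1,…,qp+p} (p the period of α, qp < c' ≤ qp+p), lab = β₁ y β₂, ci = |β₁|+1.
ChildLab : ∀ {k m} → Str k (suc m) → ℕ → Edge k m → Str k (suc m) → ℕ → Set
ChildLab {k} α c' e lab ci =
  ∃₂ λ (β₁ β₂ : List (Fin k)) → ∃₂ λ (p q : ℕ) →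
    toList α ≡ β₁ ++ (x e ∷ β₂) × β₂ ++ β₁ ≡ toList (β e) ×
    Period α p × q * p < c' × c' ≤ q * p + p ×
    q * p < suc (length β₁) × suc (length β₁) ≤ q * p + p ×
    toList lab ≡ β₁ ++ (y e ∷ β₂) × ci ≡ suc (length β₁)

-- IsConcat α c' T L : L is the concatenation (sub)tree built from T when the root
-- of T gets label α and change index c'.
data IsConcat {k m : ℕ} : Str k (suc m) → ℕ → PTree k m → LTree k m → Set where
  mk : ∀ {α c' s ch lch} →
       Pointwise (λ et lt → Σ (Str k (suc m)) λ lab → Σ ℕ λ ci →
                    ChildLab α c' (proj₁ et) lab ci × IsConcat lab ci (proj₂ et) lt) ch lch →
       IsConcat α c' (node s ch) (lnode α c' lch)

IsConcatTree : ∀ {k m} → PTree k m → ℕ → LTree k m → Set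
IsConcatTree T c L = IsConcat (rootStr T) c T L

data Side : Set where
  left right : Side

-- entries of the RCL order: label, change index, labels of proper ancestors
record Entry (k m : ℕ) : Set where
  constructor entry
  field
    label : Str k (suc m)
    cidx  : ℕ
    ancs  : List (Str k (suc m))
open Entry public

cidxT : ∀ {k m} → LTree k m → ℕ
cidxT (lnode _ c _) = c

insertK : ∀ {A : Set} → ℕ × A → List (ℕ × A) → List (ℕ × A)
insertK a [] = a ∷ []
insertK a (b ∷ bs) = if ((proj₁ b <ᵇ proj₁ a) ∨ (proj₁ b ≡ᵇ proj₁ a))
                     then (b ∷ insertK a bs) else (a ∷ b ∷ bs)

sortK : ∀ {A : Set} → List (ℕ × A) → List (ℕ × A)
sortK [] = []
sortK (a ∷ as) = insertK a (sortK as)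

isRightSide : Side → Bool
isRightSide left = false
isRightSide right = true

isLeftSide : Side → Bool
isLeftSide left = true
isLeftSide right = false

isRightChild : Side → ℕ → ℕ → Bool
isRightChild ℓ c' ci = (c' <ᵇ ci) ∨ ((c' ≡ᵇ ci) ∧ isRightSide ℓ)

isLeftChild : Side → ℕ → ℕ → Bool
isLeftChild ℓ c' ci = (ci <ᵇ c') ∨ ((ci ≡ᵇ c') ∧ isLeftSide ℓ)

select : ∀ {A : Set} → (ℕ → Bool) → List (ℕ × A) → List (ℕ × A)
select f ps = sortK (List.filterᵇ (λ p → f (proj₁ p)) ps)

mutual
  rcl : ∀ {k m} → Side → List (Str k (suc m)) → LTree k m → List (Entry k m)
  rcl ℓ anc (lnode α c ch) =
    concat (map proj₂ (select (isRightChild ℓ c) (rclCh ℓ (α ∷ anc) ch)))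
    ++ (entry α c anc ∷ [])
    ++ concat (map proj₂ (select (isLeftChild ℓ c) (rclCh ℓ (α ∷ anc) ch)))

  rclCh : ∀ {k m} → Side → List (Str k (suc m)) → List (LTree k m) → List (ℕ × List (Entry k m))
  rclCh ℓ anc [] = []
  rclCh ℓ anc (t ∷ ts) = (cidxT t , rcl ℓ anc t) ∷ rclCh ℓ anc ts

RCL : ∀ {k m} → Side → LTree k m → List (Entry k m)
RCL ℓ L = rcl ℓ [] L

PrevMod : ∀ {t} → Fin t → Fin t → Set
PrevMod {t} i j = (toℕ j ≡ suc (toℕ i)) ⊎ (toℕ j ≡ 0 × suc (toℕ i) ≡ t)

{-# OPTIONS --safe #-}
-- Call a pair (e, e′) of entries good if e′ is an ancestor of e or the change index of e′
-- exceeds the start of the acceptable range of e.  By induction on the tree, the RCL list of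
-- the subtree at a node with change index c has only good consecutive pairs, starts with a
-- change index ≥ c and ends with one ≤ c.  Indeed, the right-children blocks before the node
-- consist of descendants of the node; the first left-children block starts at or above its
-- own change index, which lies in the node's acceptable range; and consecutive blocks are
-- sorted, so a block boundary never decreases the change index, and such a step is always
-- good.  The cyclic wrap-around of the whole list is a non-decreasing step as well.  Only the
-- way labels and change indices are assigned is used, not the structure of the PCR tree.
module Submission where

open import Defs
open import Data.Nat using (ℕ; suc; _*_; _+_; _≤_; _<_; _<ᵇ_; _≡ᵇ_)
open import Data.Nat.Properties
  using (≤-refl; ≤-reflexive; ≤-trans; ≤-antisym; <⇒≤; <-≤-trans; ≤-<-trans; <-irrefl; ≮⇒≥; ≰⇒≥;
         *-monoˡ-≤; +-comm; suc-injective; <ᵇ⇒<; ≡ᵇ⇒≡; <⇒<ᵇ; ≡⇒≡ᵇ; m≤n⇒m<n∨m≡n; module ≤-Reasoning)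
open import Data.Bool using (true; false; T; _∨_)
open import Data.Bool.Properties using (T-∨; T-∧)
open import Data.List using (List; []; _∷_; _++_; length; lookup; concat; map; head; last)
open import Data.List.Membership.Propositional using (_∈_)
open import Data.List.Relation.Binary.Subset.Propositional using (_⊆_)
open import Data.List.Relation.Binary.Subset.Propositional.Properties using (⊆-refl; ⊆-trans; xs⊆x∷xs)
open import Data.List.Relation.Binary.Pointwise using (Pointwise; []; _∷_)
open import Data.List.Relation.Unary.Any using (here)
open import Data.List.Relation.Unary.All as All using (All; []; _∷_)
import Data.List.Relation.Unary.All.Properties as All
open import Data.List.Relation.Unary.AllPairs using (_∷_)
open import Data.List.Relation.Unary.Linked as Linked using (Linked; []; [-]; _∷_; _∷′_)
open import Data.List.Relation.Unary.Linked.Properties using (Linked⇒AllPairs; ++⁺)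
open import Data.Maybe using (Maybe; just)
open import Data.Maybe.Relation.Unary.All as Maybe using (just; nothing)
open import Data.Maybe.Relation.Binary.Connected using (Connected; just; nothing; just-nothing; nothing-just)
open import Data.Fin using (Fin; toℕ; zero; suc)
open import Data.Product using (Σ; _×_; _,_; proj₁; proj₂)
open import Data.Sum as Sum using (_⊎_; inj₁; inj₂; [_,_])
open import Data.Unit using (⊤; tt)
open import Data.Empty using (⊥-elim)
open import Function using (_∘_; _on_; flip; Equivalence)
open import Relation.Binary.PropositionalEquality using (_≡_; refl)
open import Relation.Nullary using (¬_; T?)
open import Relation.Nullary.Reflects using (Reflects; ofʸ; ofⁿ; fromEquivalence)

<ᵇ∨≡ᵇ⇒≤ : ∀ x y → T (x <ᵇ y) ⊎ T (x ≡ᵇ y) → x ≤ y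
<ᵇ∨≡ᵇ⇒≤ x y = [ <⇒≤ ∘ <ᵇ⇒< x y , ≤-reflexive ∘ ≡ᵇ⇒≡ x y ]

<ᵇ∨≡ᵇ-reflects-≤ : ∀ x y → Reflects (x ≤ y) ((x <ᵇ y) ∨ (x ≡ᵇ y))
<ᵇ∨≡ᵇ-reflects-≤ x y =
  fromEquivalence (<ᵇ∨≡ᵇ⇒≤ x y ∘ Equivalence.to T-∨)
                  (Equivalence.from T-∨ ∘ Sum.map <⇒<ᵇ (≡⇒≡ᵇ x y) ∘ m≤n⇒m<n∨m≡n)

isRightChild⇒≤ : ∀ ℓ c ci → T (isRightChild ℓ c ci) → c ≤ ci
isRightChild⇒≤ ℓ c ci = <ᵇ∨≡ᵇ⇒≤ c ci ∘ Sum.map₂ (proj₁ ∘ Equivalence.to T-∧) ∘ Equivalence.to T-∨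

isLeftChild⇒≤ : ∀ ℓ c ci → T (isLeftChild ℓ c ci) → ci ≤ c
isLeftChild⇒≤ ℓ c ci = <ᵇ∨≡ᵇ⇒≤ ci c ∘ Sum.map₂ (proj₁ ∘ Equivalence.to T-∧) ∘ Equivalence.to T-∨

module _ {A : Set} where

  head-++ : ∀ {P : A → Set} xs {ys} →
            Maybe.All P (head xs) → Maybe.All P (head ys) → Maybe.All P (head (xs ++ ys))
  head-++ []      _  h = h
  head-++ (_ ∷ _) h  _ = h

  last-++ : ∀ {P : A → Set} xs {ys} →
            Maybe.All P (last xs) → Maybe.All P (last ys) → Maybe.All P (last (xs ++ ys))
  last-++ []                   _ h  = h
  last-++ (x ∷ [])     {[]}    h _  = h
  last-++ (x ∷ [])     {_ ∷ _} _ h  = h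
  last-++ (x ∷ y ∷ xs)         h h′ = last-++ (y ∷ xs) h h′

  last-++-∷ : ∀ {P : A → Set} xs {y ys} →
              Maybe.All P (last (y ∷ ys)) → Maybe.All P (last (xs ++ y ∷ ys))
  last-++-∷ []           h = h
  last-++-∷ (x ∷ [])     h = h
  last-++-∷ (x ∷ y ∷ xs) h = last-++-∷ (y ∷ xs) h

  lookup-head : ∀ {P : A → Set} xs → Maybe.All P (head xs) →
                (j : Fin (length xs)) → toℕ j ≡ 0 → P (lookup xs j)
  lookup-head (x ∷ xs) (just h) zero refl = h

  lookup-last : ∀ {P : A → Set} xs → Maybe.All P (last xs) →
                (i : Fin (length xs)) → suc (toℕ i) ≡ length xs → P (lookup xs i)
  lookup-last (x ∷ [])     (just h) zero     refl = h
  lookup-last (x ∷ y ∷ xs) h        (suc i) eq   = lookup-last (y ∷ xs) h i (suc-injective eq)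

  module _ {R : A → A → Set} where

    lookup-Linked : ∀ xs → Linked R xs → (i j : Fin (length xs)) →
                    toℕ j ≡ suc (toℕ i) → R (lookup xs i) (lookup xs j)
    lookup-Linked (x ∷ y ∷ xs) (r ∷ _) zero    (suc zero) refl = r
    lookup-Linked (x ∷ y ∷ xs) (_ ∷ l) (suc i) (suc j)    eq   =
      lookup-Linked (y ∷ xs) l i j (suc-injective eq)

    All⇒Connectedˡ : ∀ {mx y} → Maybe.All (λ x → R x y) mx → Connected R mx (just y)
    All⇒Connectedˡ (just r) = just r
    All⇒Connectedˡ nothing  = nothing-just

    All⇒Connectedʳ : ∀ {x my} → Maybe.All (R x) my → Connected R (just x) my
    All⇒Connectedʳ (just r) = just r
    All⇒Connectedʳ nothing  = just-nothing

module _ {A : Set} where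

  SortedByKey : List (ℕ × A) → Set
  SortedByKey = Linked (_≤_ on proj₁)

  SortedByKey⇒All : ∀ {b bs} → SortedByKey (b ∷ bs) → All (λ b′ → proj₁ b ≤ proj₁ b′) bs
  SortedByKey⇒All s with Linked⇒AllPairs ≤-trans s
  ... | b≤bs ∷ _ = b≤bs

  insertK-All : ∀ {P : ℕ × A → Set} a bs → P a → All P bs → All P (insertK a bs)
  insertK-All a []       pa []         = pa ∷ []
  insertK-All a (b ∷ bs) pa (pb ∷ pbs) with (proj₁ b <ᵇ proj₁ a) ∨ (proj₁ b ≡ᵇ proj₁ a)
  ... | true  = pb ∷ insertK-All a bs pa pbs
  ... | false = pa ∷ pb ∷ pbs

  sortK-All : ∀ {P : ℕ × A → Set} bs → All P bs → All P (sortK bs)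
  sortK-All []       []         = []
  sortK-All (b ∷ bs) (pb ∷ pbs) = insertK-All b (sortK bs) pb (sortK-All bs pbs)

  insertK-sorted : ∀ a bs → SortedByKey bs → SortedByKey (insertK a bs)
  insertK-sorted a []       _ = [-]
  insertK-sorted a (b ∷ bs) s
    with (proj₁ b <ᵇ proj₁ a) ∨ (proj₁ b ≡ᵇ proj₁ a) | <ᵇ∨≡ᵇ-reflects-≤ (proj₁ b) (proj₁ a)
  ... | true  | ofʸ b≤a =
    All⇒Connectedʳ (All.head⁺ (insertK-All a bs b≤a (SortedByKey⇒All s)))
      ∷′ insertK-sorted a bs (Linked.tail s)
  ... | false | ofⁿ b≰a = ≰⇒≥ b≰a ∷ s

  sortK-sorted : ∀ bs → SortedByKey (sortK bs)
  sortK-sorted []       = []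
  sortK-sorted (b ∷ bs) = insertK-sorted b (sortK bs) (sortK-sorted bs)

  select-sorted : ∀ f bs → SortedByKey (select f bs)
  select-sorted f bs = sortK-sorted (Data.List.filterᵇ (f ∘ proj₁) bs)

  select-All : ∀ {P : ℕ × A → Set} f bs → All P bs →
               All (λ b → P b × T (f (proj₁ b))) (select f bs)
  select-All f bs pbs =
    sortK-All _ (All.zip (All.filter⁺ (T? ∘ f ∘ proj₁) pbs , All.all-filter (T? ∘ f ∘ proj₁) bs))

period-unique : ∀ {k n} {α : Str k n} {p p′} → Period α p → Period α p′ → p ≡ p′
period-unique (power , least) (power′ , least′) = ≤-antisym (least _ power′) (least′ _ power)

range-index-≤ : ∀ {p q q′ c} → q * p < c → c ≤ q′ * p + p → q ≤ q′
range-index-≤ {p} {q} {q′} {c} qp<c c≤q′p+p = ≮⇒≥ λ q′<q → <-irrefl refl (begin-strict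
  q * p       <⟨ qp<c ⟩
  c           ≤⟨ c≤q′p+p ⟩
  q′ * p + p  ≡⟨ +-comm (q′ * p) p ⟩
  suc q′ * p  ≤⟨ *-monoˡ-≤ p q′<q ⟩
  q * p       ∎)
  where open ≤-Reasoning

AboveRangeStart : ∀ {k n} → Str k n → ℕ → ℕ → Set
AboveRangeStart α c x = ∀ p q → Period α p → q * p < c → c ≤ q * p + p → q * p < x

AboveRangeStart-mono : ∀ {k n} {α : Str k n} {c x y} →
                       x ≤ y → AboveRangeStart α c x → AboveRangeStart α c y
AboveRangeStart-mono x≤y above p q period lo hi = <-≤-trans (above p q period lo hi) x≤y

childLab⇒AboveRangeStart : ∀ {k m} {α : Str k (suc m)} {c e lab ci} →
                           ChildLab α c e lab ci → AboveRangeStart α c ci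
childLab⇒AboveRangeStart (_ , _ , p′ , q′ , _ , _ , period′ , _ , hi′ , start , _ , _ , refl)
                         p q period lo _
  with period-unique period period′
... | refl = ≤-<-trans (*-monoˡ-≤ p (range-index-≤ {p} {q} {q′} lo hi′)) start

module _ {k m : ℕ} where

  infix 4 _⇝_

  _⇝_ : Entry k m → Entry k m → Set
  e ⇝ e′ = label e′ ∈ ancs e ⊎ AboveRangeStart (label e) (cidx e) (cidx e′)

  ≤⇒⇝ : ∀ {e e′ : Entry k m} → cidx e ≤ cidx e′ → e ⇝ e′
  ≤⇒⇝ e≤e′ = inj₂ λ _ _ _ lo _ → <-≤-trans lo e≤e′

  ≤-Connected : ∀ {x} {me me′ : Maybe (Entry k m)} →
                Maybe.All ((_≤ x) ∘ cidx) me → Maybe.All ((x ≤_) ∘ cidx) me′ → Connected _⇝_ me me′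
  ≤-Connected {me = just e} {just e′} (just e≤x) (just x≤e′) =
    just (≤⇒⇝ {e} {e′} (≤-trans e≤x x≤e′))
  ≤-Connected (just _)   nothing     = just-nothing
  ≤-Connected nothing    (just _)    = nothing-just
  ≤-Connected nothing    nothing     = nothing

  record Segment (P Q : ℕ → Set) (anc : List (Str k (suc m))) (es : List (Entry k m)) : Set where
    field
      linked   : Linked _⇝_ es
      head-sat : Maybe.All (P ∘ cidx) (head es)
      last-sat : Maybe.All (Q ∘ cidx) (last es)
      under    : All (λ e → anc ⊆ ancs e) es
  open Segment

  Block : Set
  Block = ℕ × List (Entry k m)

  entries : List Block → List (Entry k m)
  entries bs = concat (map proj₂ bs)

  BlockIn : (P Q : ℕ → Set) → List (Str k (suc m)) → Block → Set
  BlockIn P Q anc b = P (proj₁ b) × Q (proj₁ b) × Segment (proj₁ b ≤_) (_≤ proj₁ b) anc (proj₂ b)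

  entries-Segment : ∀ {P Q anc} →
                    (∀ {x y} → x ≤ y → P x → P y) → (∀ {x y} → x ≤ y → Q y → Q x) →
                    ∀ bs → SortedByKey bs → All (BlockIn P Q anc) bs → Segment P Q anc (entries bs)
  entries-Segment up down [] _ [] = record
    { linked = [] ; head-sat = nothing ; last-sat = nothing ; under = [] }
  entries-Segment {P} {Q} {anc} up down ((x , es) ∷ bs) sorted ((px , qx , seg) ∷ rest) = record
    { linked   = ++⁺ (linked seg) (≤-Connected (last-sat seg) (head-sat seg′)) (linked seg′)
    ; head-sat = head-++ es (Maybe.map (λ x≤ → up x≤ px) (head-sat seg))
                            (Maybe.map (λ x≤ → up x≤ px) (head-sat seg′))
    ; last-sat = last-++ es (Maybe.map (λ ≤x → down ≤x qx) (last-sat seg)) (last-sat seg′)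
    ; under    = All.++⁺ (under seg) (under seg′)
    }
    where
      seg′ : Segment (x ≤_) Q anc (entries bs)
      seg′ = entries-Segment (flip ≤-trans) down bs (Linked.tail sorted)
               (All.zipWith (λ { (x≤y , _ , qy , s) → x≤y , qy , s }) (SortedByKey⇒All sorted , rest))

  node-Segment : ∀ {α c anc Rs Ls} →
                 Segment (c ≤_) (λ _ → ⊤) (α ∷ anc) Rs →
                 Segment (AboveRangeStart α c) (_≤ c) (α ∷ anc) Ls →
                 Segment (c ≤_) (_≤ c) anc (Rs ++ entry α c anc ∷ Ls)
  node-Segment {α} {c} {anc} {Rs} {Ls} R L = record
    { linked   = ++⁺ (linked R)
                     (All⇒Connectedˡ (Maybe.map (λ sub → inj₁ (sub (here refl))) (All.last⁺ (under R))))
                     (All⇒Connectedʳ (Maybe.map inj₂ (head-sat L)) ∷′ linked L)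
    ; head-sat = head-++ Rs (head-sat R) (just ≤-refl)
    ; last-sat = last-++-∷ Rs (last-++ (entry α c anc ∷ []) {Ls} (just ≤-refl) (last-sat L))
    ; under    = All.++⁺ (All.map forget (under R)) (⊆-refl ∷ All.map forget (under L))
    }
    where
      forget : ∀ {as} → α ∷ anc ⊆ as → anc ⊆ as
      forget = ⊆-trans (xs⊆x∷xs anc α)

module _ {k m : ℕ} (ℓ : Side) where

  ChildBlock : Str k (suc m) → ℕ → List (Str k (suc m)) → Block → Set
  ChildBlock α c anc b =
    AboveRangeStart α c (proj₁ b) × Segment (proj₁ b ≤_) (_≤ proj₁ b) (α ∷ anc) (proj₂ b)

  mutual
    rcl-Segment : ∀ {α c T L} → IsConcat {k} {m} α c T L → ∀ anc →
                  Segment (c ≤_) (_≤ c) anc (rcl ℓ anc L)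
    rcl-Segment {α} {c} (mk {lch = lch} children) anc = node-Segment
      (entries-Segment (flip ≤-trans) (λ _ _ → tt) _ (select-sorted _ blocks)
        (All.map asRightBlock (select-All (isRightChild ℓ c) blocks (childBlocks children anc))))
      (entries-Segment AboveRangeStart-mono ≤-trans _ (select-sorted _ blocks)
        (All.map asLeftBlock (select-All (isLeftChild ℓ c) blocks (childBlocks children anc))))
      where
        blocks : List Block
        blocks = rclCh ℓ (α ∷ anc) lch

        asRightBlock : ∀ {b} → ChildBlock α c anc b × T (isRightChild ℓ c (proj₁ b)) →
                       BlockIn (c ≤_) (λ _ → ⊤) (α ∷ anc) b
        asRightBlock ((_ , seg) , isRight) = isRightChild⇒≤ ℓ c _ isRight , tt , seg

        asLeftBlock : ∀ {b} → ChildBlock α c anc b × T (isLeftChild ℓ c (proj₁ b)) →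
                      BlockIn (AboveRangeStart α c) (_≤ c) (α ∷ anc) b
        asLeftBlock ((above , seg) , isLeft) = above , isLeftChild⇒≤ ℓ c _ isLeft , seg

    childBlocks : ∀ {α c ch lch} →
      Pointwise (λ et lt → Σ (Str k (suc m)) λ lab → Σ ℕ λ ci →
                   ChildLab α c (proj₁ et) lab ci × IsConcat lab ci (proj₂ et) lt) ch lch →
      ∀ anc → All (ChildBlock α c anc) (rclCh ℓ (α ∷ anc) lch)
    childBlocks []                                                  anc = []
    childBlocks ((_ , _ , childLab , isConcat@(mk _)) ∷ children) anc =
      (childLab⇒AboveRangeStart childLab , rcl-Segment isConcat _) ∷ childBlocks children anc

lemma4 : ∀ {k m : ℕ} (T : PTree k m) (c : ℕ) (ℓ : Side) (L : LTree k m) →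
    ValidPCR T → DistinctClasses T → ChainProperty T →
    1 ≤ c → c ≤ suc m →
    IsConcatTree T c L →
    (i j : Fin (length (RCL ℓ L))) → PrevMod i j →
    ¬ (label (lookup (RCL ℓ L) j) ∈ ancs (lookup (RCL ℓ L) i)) →
    (p q : ℕ) → Period (label (lookup (RCL ℓ L) i)) p → p < suc m →
    q * p < cidx (lookup (RCL ℓ L) i) → cidx (lookup (RCL ℓ L) i) ≤ q * p + p →
    q * p < cidx (lookup (RCL ℓ L) j)
lemma4 T c ℓ L _ _ _ _ _ isConcat i j prev notAncestor p q period _ lo hi =
  [ ⊥-elim ∘ notAncestor , (λ above → above p q period lo hi) ] (step prev)
  where
    open Segment (rcl-Segment ℓ isConcat [])
    es = RCL ℓ L

    step : PrevMod i j → lookup es i ⇝ lookup es j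
    step (inj₁ j≡i+1)        = lookup-Linked es linked i j j≡i+1
    step (inj₂ (j≡0 , i+1≡t)) =
      ≤⇒⇝ {e = lookup es i} {lookup es j}
          (≤-trans (lookup-last es last-sat i i+1≡t) (lookup-head es head-sat j j≡0))
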